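{- Let $S$ be a twisted agreeable semigroup, regarded as a restriction semigroup with $D(s):=s*s$, and let $\theta:S\to\mathcal P(S_0)$ be the map defined below. Then $\theta$ correctly represents $*$: $\theta(a*b)=\theta(a)*\theta(b)$ for all $a,b\in S$, where for partial functions $f,g$ on a set, $f*g$ is the identity map restricted to $\{x\mid f(x),g(x)\text{ both defined and }f(x)=g(x)\}$.
   Context: A twisted agreeable semigroup is a semigroup $S$ with a binary operation $*$ satisfying, for all $s,t,u,v\in S$: $(s*s)s=s$; $s*t=t*s$; $(s*t)s=(s*t)t$; $((u*v)s)*t=(s*t)(u*v)$; $u(s*t)=(us*ut)u$. With $D(s):=s*s$, $S$ is a restriction semigroup. $D(S)=\{D(s)\mid s\in S\}$ is ordered by $\mathsf e\le\mathsf f$ iff $\mathsf e=\mathsf e\mathsf f$; the natural order on $S$ is $s\le t$ iff $s=D(s)t$. A filter of $D(S)$ is a subset closed under multiplication and upward closed in $D(S)$. For $a\not\le b$, a filter $F$ is $(a,b)$-separating if $D(a)\in F$ and no $\mathsf e\in F$ has $\mathsf e a=\mathsf e b$; maximally $(a,b)$-separating if maximal under inclusion among such. Partial functions compose left to right. Construction: for a filter $F$, let $W_F=\{a\in S\mid D(a)\notin F\}$, $a\mathrel{\epsilon_F}b$ iff $\mathsf e a=\mathsf e b$ for some $\mathsf e\in F$; $S_F=(S\setminus W_F)/\epsilon_F$ with $\bar x$ the class of $x$; for $s\in S$, $\psi^F_s(\bar x)=\overline{xs}$ if $xs\notin W_F$, undefined otherwise. $S_0$ is the disjoint union of the $S_F$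 over all maximally $(a,b)$-separating filters $F$, over all pairs $a\not\le b$, and $\theta(s)$ is the union of the $\psi^F_s$ over these $F$. -}

module Defs where

open import Level using (Level; _⊔_; suc; Lift)
open import Data.Product using (Σ; ∃; _×_; _,_)
open import Relation.Binary.PropositionalEquality using (_≡_)
open import Relation.Nullary using (¬_)

record TASemigroup (c : Level) : Set (suc c) where
  infixl 7 _∙_
  infix 6 _⋆_
  field
    Carrier : Set c
    _∙_     : Carrier → Carrier → Carrier
    _⋆_     : Carrier → Carrier → Carrier
    assoc   : ∀ x y z → (x ∙ y) ∙ z ≡ x ∙ (y ∙ z)
    ax1     : ∀ s → (s ⋆ s) ∙ s ≡ s
    ax2     : ∀ s t → s ⋆ t ≡ t ⋆ s
    ax3     : ∀ s t → (s ⋆ t) ∙ s ≡ (s ⋆ t) ∙ t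
    ax4     : ∀ s t u v → ((u ⋆ v) ∙ s) ⋆ t ≡ (s ⋆ t) ∙ (u ⋆ v)
    ax5     : ∀ s t u → u ∙ (s ⋆ t) ≡ ((u ∙ s) ⋆ (u ∙ t)) ∙ u

module Construction {c : Level} (S : TASemigroup c) (ℓ : Level) where
  open TASemigroup S

  D : Carrier → Carrier
  D s = s ⋆ s

  InD : Carrier → Set c
  InD e = ∃ λ s → e ≡ D s

  _≤ₙ_ : Carrier → Carrier → Set c
  s ≤ₙ t = s ≡ D s ∙ t

  Subset : Set (c ⊔ suc ℓ)
  Subset = Carrier → Set ℓ

  _⊆_ : Subset → Subset → Set (c ⊔ ℓ)
  F ⊆ G = ∀ e → F e → G e

  record IsFilter (F : Subset) : Set (c ⊔ ℓ) where
    field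
      inD    : ∀ e → F e → InD e
      mulCl  : ∀ e f → F e → F f → F (e ∙ f)
      upCl   : ∀ e f → F e → InD f → e ≡ e ∙ f → F f

  record Separating (a b : Carrier) (F : Subset) : Set (c ⊔ ℓ) where
    field
      filter : IsFilter F
      hasDa  : F (D a)
      sep    : ∀ e → F e → ¬ (e ∙ a ≡ e ∙ b)

  record MaxSeparating (a b : Carrier) (F : Subset) : Set (c ⊔ suc ℓ) where
    field
      separating : Separating a b F
      maximal    : ∀ G → Separating a b G → F ⊆ G → G ⊆ F

  εrel : Subset → Carrier → Carrier → Set (c ⊔ ℓ)
  εrel F x y = ∃ λ e → F e × (e ∙ x ≡ e ∙ y)

  -- points of S₀ = disjoint union of S_F over all maximally (a,b)-separating filters F
  -- (a ≰ b); a point is a component F together with a representative x ∉ W_F.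
  record Point : Set (c ⊔ suc ℓ) where
    constructor pt
    field
      F      : Subset
      a b    : Carrier
      a≰b    : ¬ (a ≤ₙ b)
      maxSep : MaxSeparating a b F
      x      : Carrier
      x∉W    : F (D x)

  _≈₀_ : Point → Point → Set (c ⊔ ℓ)
  p ≈₀ q = (Point.F p ⊆ Point.F q) × (Point.F q ⊆ Point.F p)
         × εrel (Point.F p) (Point.x p) (Point.x q)

  -- partial functions on S₀, encoded as graphs: f p q means "f(p) is defined and equals q"
  PFun : Set (suc (c ⊔ suc ℓ))
  PFun = Point → Point → Set (c ⊔ suc ℓ)

  _≐_ : PFun → PFun → Set (c ⊔ suc ℓ)
  f ≐ g = ∀ p q → (f p q → g p q) × (g p q → f p q)

  _*ₚ_ : PFun → PFun → PFun
  (f *ₚ g) p q = Σ Point λ r → Σ Point λ r' → f p r × g p r' × r ≈₀ r' × p ≈₀ q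

  -- ψ^F_s(x̄) = class of xs, when xs ∉ W_F
  shift : (p : Point) (s : Carrier) → Point.F p (D (Point.x p ∙ s)) → Point
  shift (pt F a b n m x _) s d = pt F a b n m (x ∙ s) d

  θ : Carrier → PFun
  θ s p q = Lift (c ⊔ suc ℓ) (Σ (Point.F p (D (Point.x p ∙ s))) λ d → shift p s d ≈₀ q)

module Submission where

-- The elements s ⋆ t of a twisted agreeable semigroup are commuting idempotents, and
-- D (x(a ⋆ b)) = D x · (xa ⋆ xb).  Hence a filter F contains D (x(a ⋆ b)) exactly when it
-- contains D x and the idempotent xa ⋆ xb, and, given D (xa) ∈ F, the latter holds exactly
-- when xa ε_F xb.  So the domain of θ(a ⋆ b) on S_F is the set of x̄ where θ(a) and θ(b)
-- are defined and agree, and on it θ(a ⋆ b) acts as the identity since x(a ⋆ b) ε_F x.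

open import Level using (Level; lift) renaming (zero to 0ℓ)
open import Defs
open import Data.Product using (_,_)
open import Relation.Binary.PropositionalEquality
open ≡-Reasoning
open import Relation.Binary.Bundles using (Setoid)
import Relation.Binary.Reasoning.Setoid as SetoidReasoning

module TASemigroupProperties {c} (S : TASemigroup c) where
  open TASemigroup S
  -- D does not depend on the level of the construction; any level will do.
  open Construction S 0ℓ using (D)

  D-idem : ∀ s → D s ∙ D s ≡ D s
  D-idem s = trans (sym (ax4 s s s s)) (cong (_⋆ s) (ax1 s))

  ⋆≡⋆∙Dˡ : ∀ s t → s ⋆ t ≡ (s ⋆ t) ∙ D s
  ⋆≡⋆∙Dˡ s t = trans (cong (_⋆ t) (sym (ax1 s))) (ax4 s t s s)

  ⋆≡⋆∙Dʳ : ∀ s t → s ⋆ t ≡ (s ⋆ t) ∙ D t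
  ⋆≡⋆∙Dʳ s t = trans (ax2 s t) (trans (⋆≡⋆∙Dˡ t s) (cong (_∙ D t) (ax2 t s)))

  D-⋆∙-expand : ∀ u v s → D ((u ⋆ v) ∙ s) ≡ (D s ∙ (u ⋆ v)) ∙ (u ⋆ v)
  D-⋆∙-expand u v s = begin
    ((u ⋆ v) ∙ s) ⋆ ((u ⋆ v) ∙ s) ≡⟨ ax4 s ((u ⋆ v) ∙ s) u v ⟩
    (s ⋆ ((u ⋆ v) ∙ s)) ∙ (u ⋆ v) ≡⟨ cong (_∙ (u ⋆ v)) (ax2 s _) ⟩
    (((u ⋆ v) ∙ s) ⋆ s) ∙ (u ⋆ v) ≡⟨ cong (_∙ (u ⋆ v)) (ax4 s s u v) ⟩
    (D s ∙ (u ⋆ v)) ∙ (u ⋆ v)     ∎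

  ⋆∙⋆≡D∙⋆ : ∀ s t → (s ⋆ t) ∙ (s ⋆ t) ≡ D s ∙ (s ⋆ t)
  ⋆∙⋆≡D∙⋆ s t = subst (λ p → p ∙ p ≡ D s ∙ p) (ax2 t s) (begin
    (t ⋆ s) ∙ (t ⋆ s)       ≡⟨ sym (ax4 t s t s) ⟩
    ((t ⋆ s) ∙ t) ⋆ s       ≡⟨ cong (_⋆ s) (ax3 t s) ⟩
    ((t ⋆ s) ∙ s) ⋆ s       ≡⟨ ax4 s s t s ⟩
    D s ∙ (t ⋆ s)           ∎)

  D∙⋆≡⋆ : ∀ s t → D s ∙ (s ⋆ t) ≡ s ⋆ t
  D∙⋆≡⋆ s t = sym (begin
    p                      ≡⟨ ⋆≡⋆∙Dˡ s t ⟩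
    p ∙ D s                ≡⟨ ax5 s s p ⟩
    D (p ∙ s) ∙ p          ≡⟨ cong (_∙ p) (D-⋆∙-expand s t s) ⟩
    ((D s ∙ p) ∙ p) ∙ p    ≡⟨ cong (_∙ p) Dp∙p≡Dp ⟩
    (D s ∙ p) ∙ p          ≡⟨ Dp∙p≡Dp ⟩
    D s ∙ p                ∎)
    where
    p = s ⋆ t
    Dp∙p≡Dp : (D s ∙ p) ∙ p ≡ D s ∙ p
    Dp∙p≡Dp = begin
      (D s ∙ p) ∙ p        ≡⟨ assoc _ _ _ ⟩
      D s ∙ (p ∙ p)        ≡⟨ cong (D s ∙_) (⋆∙⋆≡D∙⋆ s t) ⟩
      D s ∙ (D s ∙ p)      ≡⟨ sym (assoc _ _ _) ⟩
      (D s ∙ D s) ∙ p      ≡⟨ cong (_∙ p) (D-idem s) ⟩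
      D s ∙ p              ∎

  ⋆-idem : ∀ s t → (s ⋆ t) ∙ (s ⋆ t) ≡ s ⋆ t
  ⋆-idem s t = trans (⋆∙⋆≡D∙⋆ s t) (D∙⋆≡⋆ s t)

  D-⋆ : ∀ s t → D (s ⋆ t) ≡ s ⋆ t
  D-⋆ s t = begin
    p ⋆ p        ≡⟨ cong (_⋆ p) (sym (⋆-idem s t)) ⟩
    (p ∙ p) ⋆ p  ≡⟨ ax4 p p s t ⟩
    D p ∙ p      ≡⟨ ax1 p ⟩
    p            ∎
    where p = s ⋆ t

  D-⋆∙ : ∀ u v s → D ((u ⋆ v) ∙ s) ≡ D s ∙ (u ⋆ v)
  D-⋆∙ u v s = trans (D-⋆∙-expand u v s) (trans (assoc _ _ _) (cong (D s ∙_) (⋆-idem u v)))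

  ⋆-∙-comm : ∀ u v s t → (u ⋆ v) ∙ (s ⋆ t) ≡ (s ⋆ t) ∙ (u ⋆ v)
  ⋆-∙-comm u v s t = begin
    p ∙ (s ⋆ t)                    ≡⟨ ax5 s t p ⟩
    ((p ∙ s) ⋆ (p ∙ t)) ∙ p        ≡⟨ cong (_∙ p) (ax4 s (p ∙ t) u v) ⟩
    ((s ⋆ (p ∙ t)) ∙ p) ∙ p        ≡⟨ cong (λ z → (z ∙ p) ∙ p) (ax2 s _) ⟩
    (((p ∙ t) ⋆ s) ∙ p) ∙ p        ≡⟨ cong (λ z → (z ∙ p) ∙ p) (ax4 t s u v) ⟩
    (((t ⋆ s) ∙ p) ∙ p) ∙ p        ≡⟨ assoc _ _ _ ⟩
    ((t ⋆ s) ∙ p) ∙ (p ∙ p)        ≡⟨ cong (((t ⋆ s) ∙ p) ∙_) (⋆-idem u v) ⟩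
    ((t ⋆ s) ∙ p) ∙ p              ≡⟨ assoc _ _ _ ⟩
    (t ⋆ s) ∙ (p ∙ p)              ≡⟨ cong₂ _∙_ (ax2 t s) (⋆-idem u v) ⟩
    (s ⋆ t) ∙ p                    ∎
    where p = u ⋆ v

  ⋆∙⋆≡⋆∙D : ∀ r r' u v → (r ⋆ r') ∙ u ≡ (r ⋆ r') ∙ v → (r ⋆ r') ∙ (u ⋆ v) ≡ (r ⋆ r') ∙ D u
  ⋆∙⋆≡⋆∙D r r' u v eq = begin
    e ∙ (u ⋆ v)                ≡⟨ ax5 u v e ⟩
    ((e ∙ u) ⋆ (e ∙ v)) ∙ e    ≡⟨ cong (λ z → ((e ∙ u) ⋆ z) ∙ e) (sym eq) ⟩
    D (e ∙ u) ∙ e              ≡⟨ cong (_∙ e) (D-⋆∙ r r' u) ⟩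
    (D u ∙ e) ∙ e              ≡⟨ assoc _ _ _ ⟩
    D u ∙ (e ∙ e)              ≡⟨ cong (D u ∙_) (⋆-idem r r') ⟩
    D u ∙ e                    ≡⟨ ⋆-∙-comm u u r r' ⟩
    e ∙ D u                    ∎
    where e = r ⋆ r'

  ⋆∙D≡⋆∙D∙⋆ : ∀ r r' u v → (r ⋆ r') ∙ u ≡ (r ⋆ r') ∙ v
            → (r ⋆ r') ∙ D u ≡ ((r ⋆ r') ∙ D u) ∙ (u ⋆ v)
  ⋆∙D≡⋆∙D∙⋆ r r' u v eq = begin
    e ∙ D u              ≡⟨ sym (⋆∙⋆≡⋆∙D r r' u v eq) ⟩
    e ∙ (u ⋆ v)          ≡⟨ cong (e ∙_) (sym (⋆-idem u v)) ⟩
    e ∙ ((u ⋆ v) ∙ (u ⋆ v)) ≡⟨ sym (assoc _ _ _) ⟩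
    (e ∙ (u ⋆ v)) ∙ (u ⋆ v) ≡⟨ cong (_∙ (u ⋆ v)) (⋆∙⋆≡⋆∙D r r' u v eq) ⟩
    (e ∙ D u) ∙ (u ⋆ v)  ∎
    where e = r ⋆ r'

  D-∙⋆ : ∀ x a b → D (x ∙ (a ⋆ b)) ≡ D x ∙ ((x ∙ a) ⋆ (x ∙ b))
  D-∙⋆ x a b = trans (cong D (ax5 a b x)) (D-⋆∙ (x ∙ a) (x ∙ b) x)

  D-∙⋆∙-cancel : ∀ x a b → D (x ∙ (a ⋆ b)) ∙ x ≡ D (x ∙ (a ⋆ b)) ∙ (x ∙ (a ⋆ b))
  D-∙⋆∙-cancel x a b = begin
    D y ∙ x          ≡⟨ cong (_∙ x) (D-∙⋆ x a b) ⟩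
    (D x ∙ P) ∙ x    ≡⟨ cong (_∙ x) (⋆-∙-comm x x (x ∙ a) (x ∙ b)) ⟩
    (P ∙ D x) ∙ x    ≡⟨ assoc _ _ _ ⟩
    P ∙ (D x ∙ x)    ≡⟨ cong (P ∙_) (ax1 x) ⟩
    P ∙ x            ≡⟨ sym (ax5 a b x) ⟩
    y                ≡⟨ sym (ax1 y) ⟩
    D y ∙ y          ∎
    where
    P = (x ∙ a) ⋆ (x ∙ b)
    y = x ∙ (a ⋆ b)

module FilterProperties {c} (S : TASemigroup c) (ℓ : Level) where
  open TASemigroup S
  open Construction S ℓ
  open TASemigroupProperties S

  module _ {F : Subset} (isF : IsFilter F) where
    open IsFilter isF

    ∈F-comm : ∀ {e f} → F e → F f → e ∙ f ≡ f ∙ e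
    ∈F-comm {e} {f} Fe Ff with inD e Fe | inD f Ff
    ... | s , refl | t , refl = ⋆-∙-comm s s t t

    ε-sym : ∀ {u v} → εrel F u v → εrel F v u
    ε-sym (e , Fe , eq) = e , Fe , sym eq

    ε-trans : ∀ {u v w} → εrel F u v → εrel F v w → εrel F u w
    ε-trans {u} {v} {w} (e , Fe , eu≡ev) (f , Ff , fv≡fw) = e ∙ f , mulCl e f Fe Ff , (begin
      (e ∙ f) ∙ u    ≡⟨ cong (_∙ u) (∈F-comm Fe Ff) ⟩
      (f ∙ e) ∙ u    ≡⟨ assoc _ _ _ ⟩
      f ∙ (e ∙ u)    ≡⟨ cong (f ∙_) eu≡ev ⟩
      f ∙ (e ∙ v)    ≡⟨ sym (assoc _ _ _) ⟩
      (f ∙ e) ∙ v    ≡⟨ cong (_∙ v) (∈F-comm Ff Fe) ⟩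
      (e ∙ f) ∙ v    ≡⟨ assoc _ _ _ ⟩
      e ∙ (f ∙ v)    ≡⟨ cong (e ∙_) fv≡fw ⟩
      e ∙ (f ∙ w)    ≡⟨ sym (assoc _ _ _) ⟩
      (e ∙ f) ∙ w    ∎)

    ∈F-∙⋆⇒∈F-Dˡ : ∀ {e s t} → F (e ∙ (s ⋆ t)) → F (D s)
    ∈F-∙⋆⇒∈F-Dˡ {e} {s} {t} Fe∙p = upCl _ (D s) Fe∙p (s , refl)
      (trans (cong (e ∙_) (⋆≡⋆∙Dˡ s t)) (sym (assoc _ _ _)))

    ∈F-∙⋆⇒∈F-Dʳ : ∀ {e s t} → F (e ∙ (s ⋆ t)) → F (D t)
    ∈F-∙⋆⇒∈F-Dʳ {e} {s} {t} Fe∙p = upCl _ (D t) Fe∙p (t , refl)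
      (trans (cong (e ∙_) (⋆≡⋆∙Dʳ s t)) (sym (assoc _ _ _)))

    ∈F-∙⋆⇒ε : ∀ {e s t} → F (e ∙ (s ⋆ t)) → εrel F s t
    ∈F-∙⋆⇒ε {e} {s} {t} Fe∙p = e ∙ (s ⋆ t) , Fe∙p ,
      trans (assoc _ _ _) (trans (cong (e ∙_) (ax3 s t)) (sym (assoc _ _ _)))

    ε⇒∈F-⋆ : ∀ {s t} → F (D s) → εrel F s t → F (s ⋆ t)
    ε⇒∈F-⋆ {s} {t} FDs (e , Fe , es≡et) with inD e Fe
    ... | r , refl = upCl _ (s ⋆ t) (mulCl _ _ Fe FDs) (s ⋆ t , sym (D-⋆ s t))
      (⋆∙D≡⋆∙D∙⋆ r r s t es≡et)

  ε-mono : ∀ {F G : Subset} {u v} → F ⊆ G → εrel F u v → εrel G u v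
  ε-mono F⊆G (e , Fe , eq) = e , F⊆G e Fe , eq

module PointProperties {c} (S : TASemigroup c) (ℓ : Level) where
  open TASemigroup S
  open Construction S ℓ
  open FilterProperties S ℓ

  filterOf : (p : Point) → IsFilter (Point.F p)
  filterOf p = Separating.filter (MaxSeparating.separating (Point.maxSep p))

  ⊆-refl : ∀ {F} → F ⊆ F
  ⊆-refl _ Fe = Fe

  ⊆-trans : ∀ {F G H} → F ⊆ G → G ⊆ H → F ⊆ H
  ⊆-trans F⊆G G⊆H e Fe = G⊆H e (F⊆G e Fe)

  ≈₀-refl : ∀ p → p ≈₀ p
  ≈₀-refl p = ⊆-refl , ⊆-refl , Construction.D S ℓ (Point.x p) , Point.x∉W p , refl

  ≈₀-sym : ∀ {p q} → p ≈₀ q → q ≈₀ p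
  ≈₀-sym {p} (F⊆G , G⊆F , ε) = G⊆F , F⊆G , ε-mono F⊆G (ε-sym (filterOf p) ε)

  ≈₀-trans : ∀ {p q r} → p ≈₀ q → q ≈₀ r → p ≈₀ r
  ≈₀-trans {p} (F⊆G , G⊆F , ε₁) (G⊆H , H⊆G , ε₂) =
    ⊆-trans F⊆G G⊆H , ⊆-trans H⊆G G⊆F , ε-trans (filterOf p) ε₁ (ε-mono G⊆F ε₂)

  S₀ : Setoid _ _
  S₀ = record
    { Carrier = Point
    ; _≈_ = _≈₀_
    ; isEquivalence = record
      { refl = λ {p} → ≈₀-refl p ; sym = λ {p q} → ≈₀-sym {p} {q} ; trans = λ {p q r} → ≈₀-trans {p} {q} {r} }
    }

  θ-shift : ∀ {s} p (d : Point.F p (D (Point.x p ∙ s))) → θ s p (shift p s d)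
  θ-shift {s} p@(pt _ _ _ _ _ _ _) d = lift (d , ≈₀-refl (shift p s d))

module RepresentsStar {c} (ℓ : Level) (S : TASemigroup c) (a b : TASemigroup.Carrier S) where
  open TASemigroup S
  open Construction S ℓ
  open TASemigroupProperties S
  open FilterProperties S ℓ
  open PointProperties S ℓ
  open SetoidReasoning S₀ renaming (begin_ to begin₀_; _∎ to _∎₀)

  shift-⋆≈ : ∀ p d → shift p (a ⋆ b) d ≈₀ p
  shift-⋆≈ p@(pt F _ _ _ _ x _) d =
    ⊆-refl {F} , ⊆-refl {F} , ε-sym (filterOf p) (D (x ∙ (a ⋆ b)) , d , D-∙⋆∙-cancel x a b)

  θ⋆⇒θ*θ : ∀ p q → θ (a ⋆ b) p q → (θ a *ₚ θ b) p q
  θ⋆⇒θ*θ p@(pt F _ _ _ _ x _) q (lift (d , shift≈q)) =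
    shift p a FDxa , shift p b FDxb , θ-shift p FDxa , θ-shift p FDxb ,
    (⊆-refl {F} , ⊆-refl {F} , ∈F-∙⋆⇒ε isF {D x} FDx∙P) ,
    (begin₀ p ≈⟨ shift-⋆≈ p d ⟨ shift p (a ⋆ b) d ≈⟨ shift≈q ⟩ q ∎₀)
    where
    isF = filterOf p
    FDx∙P : F (D x ∙ ((x ∙ a) ⋆ (x ∙ b)))
    FDx∙P = subst F (D-∙⋆ x a b) d
    FDxa : F (D (x ∙ a))
    FDxa = ∈F-∙⋆⇒∈F-Dˡ isF {D x} FDx∙P
    FDxb : F (D (x ∙ b))
    FDxb = ∈F-∙⋆⇒∈F-Dʳ isF {D x} FDx∙P

  θ*θ⇒θ⋆ : ∀ p q → (θ a *ₚ θ b) p q → θ (a ⋆ b) p q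
  θ*θ⇒θ⋆ p@(pt F _ _ _ _ x FDx) q
    (r , r' , lift (FDxa , sa≈r) , lift (FDxb , sb≈r') , r≈r' , p≈q) =
    lift (d , (begin₀ shift p (a ⋆ b) d ≈⟨ shift-⋆≈ p d ⟩ p ≈⟨ p≈q ⟩ q ∎₀))
    where
    isF = filterOf p
    sa≈sb : shift p a FDxa ≈₀ shift p b FDxb
    sa≈sb = begin₀
      shift p a FDxa  ≈⟨ sa≈r ⟩
      r               ≈⟨ r≈r' ⟩
      r'              ≈⟨ sb≈r' ⟨
      shift p b FDxb  ∎₀
    d : F (D (x ∙ (a ⋆ b)))
    d = let _ , _ , εxa,xb = sa≈sb
            FP = ε⇒∈F-⋆ isF {x ∙ a} {x ∙ b} FDxa εxa,xb
        in subst F (sym (D-∙⋆ x a b)) (IsFilter.mulCl isF _ _ FDx FP)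

lemma2p12 : ∀ {c} (ℓ : Level) (S : TASemigroup c) (a b : TASemigroup.Carrier S)
    → Construction._≐_ S ℓ (Construction.θ S ℓ (TASemigroup._⋆_ S a b))
    (Construction._*ₚ_ S ℓ (Construction.θ S ℓ a) (Construction.θ S ℓ b))
lemma2p12 ℓ S a b p q = θ⋆⇒θ*θ p q , θ*θ⇒θ⋆ p q
  where open RepresentsStar ℓ S a b
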